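{- Let $a,b,c,e\in\mathbb Z$ with $a\neq 0$ and $e>0$, and let $h_3(j)=aj^3+bj^2+cj+e$ for $j\in\mathbb Z_{\geq 0}$, where it is assumed that $h_3(j)\geq 0$ for all $j\geq 0$ (so $h_3\in\mathcal H_0$). (1) If $b,c\geq 0$ then $\operatorname{hdepth}(h_3)\leq 16$. (2) If $b<0$ and $b^2\leq 3ac$ then $\operatorname{hdepth}(h_3)\leq 67$.
   Context: $\mathcal H_0$ denotes the set of functions $h:\mathbb Z_{\geq 0}\to\mathbb Z_{\geq 0}$ with $h(0)>0$. For $h\in\mathcal H_0$ and integers $0\leq k\leq d$, set $\beta_k^d(h)=\sum_{j=0}^k(-1)^{k-j}\binom{d-j}{k-j}h(j)$. The Hilbert depth of $h$ is $\operatorname{hdepth}(h)=\max\{d\in\mathbb Z_{\geq 0}\;:\;\beta_k^d(h)\geq 0\text{ for all }0\leq k\leq d\}$. -}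

module Defs where

open import Data.Nat using (ℕ; zero; suc; _∸_; _≤_)
open import Data.Nat.Combinatorics using (_C_)
open import Data.Integer using (ℤ; +_; -_; _+_; _*_; _>_) renaming (_≤_ to _≤ℤ_)

sgn : ℕ → ℤ
sgn zero = + 1
sgn (suc n) = - sgn n

sumTo : ℕ → (ℕ → ℤ) → ℤ
sumTo zero f = f 0
sumTo (suc k) f = sumTo k f + f (suc k)

β : (h : ℕ → ℤ) → (k d : ℕ) → ℤ
β h k d = sumTo k (λ j → sgn (k ∸ j) * (+ ((d ∸ j) C (k ∸ j)) * h j))

-- d belongs to the set whose maximum is hdepth(h):
-- β_k^d(h) ≥ 0 for all 0 ≤ k ≤ d
HdepthAdmissible : (h : ℕ → ℤ) → ℕ → Set
HdepthAdmissible h d = ∀ k → k ≤ d → + 0 ≤ℤ β h k d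

HdepthAtMost : (h : ℕ → ℤ) → ℕ → Set
HdepthAtMost h m = ∀ d → HdepthAdmissible h d → d ≤ m

cubic : (a b c e : ℤ) → ℕ → ℤ
cubic a b c e j = a * (+ j * + j * + j) + b * (+ j * + j) + c * + j + e

{-# OPTIONS --safe #-}
-- Only β₁ and β₂ matter. For d = n + 1, β₁ = h(1) - d h(0) and n β₁ + 2 β₂ = 2 h(2) - n h(1),
-- so an admissible d ≥ 2 has h(0) ≤ h(1) and n h(1) ≤ 2 h(2).
-- (1) For b, c ≥ 0, 16 h(1) - 2 h(2) = 8b + 12c + 14e > 0, so n < 16.
-- (2) For b < 0, h(0) ≤ h(1) gives a + c ≥ -b > 0 and b² ≤ 3ac gives ac > 0, hence a, c > 0.
-- Now n h(1) ≤ 2 h(2) says (n - 16) a + (n - 4) c + (n - 2) e ≤ (n - 8)(-b), and AM-GM gives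
-- 4 (n - 16)(n - 4) ac ≤ ((n - 16) a + (n - 4) c)² ≤ (n - 8)² b² ≤ 3 (n - 8)² ac.
-- But 4 (n - 16)(n - 4) - 3 (n - 8)² = (n - 30)(n - 2) + 4 > 0 once n ≥ 30, so in fact d ≤ 30.
module Submission where

open import Defs
open import Data.Nat using (ℕ)
open import Data.Product using (_×_; _,_)
open import Data.Integer using (ℤ; +_; _*_; _<_; _≤_; _>_)
open import Relation.Binary.PropositionalEquality using (_≢_)

open import Data.Empty using (⊥)
open import Data.List.Base using ([]; _∷_)
open import Data.Nat.Base as ℕ using (zero; suc; _∸_; z≤n; s≤s; z<s)
import Data.Nat.Properties as ℕ
import Data.Nat.Tactic.RingSolver as ℕ-Solver
open import Data.Nat.Combinatorics using (_C_; nC1≡n; nCk+nC[k+1]≡[n+1]C[k+1])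
open import Data.Integer.Base
  using (-_; _+_; _-_; +0; -[1+_]; +[1+_]; +≤+; +<+; positive; nonNegative)
open import Data.Integer.Properties
open import Data.Integer.Tactic.RingSolver using (solve; solve-∀)
open import Relation.Binary.PropositionalEquality
  using (_≡_; refl; sym; cong; subst; subst₂; module ≡-Reasoning)
open import Relation.Nullary using (¬_; yes; no; contradiction)

0≤i*j : ∀ {i j} → + 0 ≤ i → + 0 ≤ j → + 0 ≤ i * j
0≤i*j (+≤+ {n = m} _) (+≤+ {n = n} _) = subst (+ 0 ≤_) (pos-* m n) (+≤+ z≤n)

0<i*j : ∀ {i j} → + 0 < i → + 0 < j → + 0 < i * j
0<i*j {+0} (+<+ ()) _
0<i*j {+[1+ _ ]} {+0} _ (+<+ ())
0<i*j {+[1+ _ ]} {+[1+ _ ]} _ _ = +<+ z<s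

0≤i*i : ∀ i → + 0 ≤ i * i
0≤i*i (+ n) = 0≤i*j {+ n} {+ n} (+≤+ z≤n) (+≤+ z≤n)
0≤i*i -[1+ n ] = +≤+ z≤n

0<i*j∧0<i+j⇒0<i : ∀ {i j} → + 0 < i * j → + 0 < i + j → + 0 < i
0<i*j∧0<i+j⇒0<i {+[1+ _ ]} _ _ = +<+ z<s
0<i*j∧0<i+j⇒0<i {+0} (+<+ ()) _
0<i*j∧0<i+j⇒0<i { -[1+ _ ]} {+0} _ ()
0<i*j∧0<i+j⇒0<i { -[1+ _ ]} {+[1+ _ ]} () _
0<i*j∧0<i+j⇒0<i { -[1+ _ ]} { -[1+ _ ]} _ ()

i<i+j : ∀ i {j} → + 0 < j → i < i + j
i<i+j i {j} 0<j = begin-strict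
  i        ≡⟨ +-identityʳ i ⟨
  i + + 0  <⟨ +-monoʳ-< i 0<j ⟩
  i + j    ∎
  where open ≤-Reasoning

0≤i≤j⇒i*i≤j*j : ∀ {i j} → + 0 ≤ i → i ≤ j → i * i ≤ j * j
0≤i≤j⇒i*i≤j*j {i} {j} 0≤i i≤j = begin
  i * i  ≤⟨ *-monoˡ-≤-nonNeg i {{nonNegative 0≤i}} i≤j ⟩
  i * j  ≤⟨ *-monoʳ-≤-nonNeg j {{nonNegative (≤-trans 0≤i i≤j)}} i≤j ⟩
  j * j  ∎
  where open ≤-Reasoning

4ij≤[i+j]² : ∀ i j → + 4 * (i * j) ≤ (i + j) * (i + j)
4ij≤[i+j]² i j = begin
  + 4 * (i * j)                      ≤⟨ i≤i+j _ _ {{nonNegative (0≤i*i (i - j))}} ⟩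
  + 4 * (i * j) + (i - j) * (i - j)  ≡⟨ solve (i ∷ j ∷ []) ⟩
  (i + j) * (i + j)                  ∎
  where open ≤-Reasoning

pa+rc≤qt⇒4pr≤3q² : ∀ {a c p q r t} → + 0 < a → + 0 < c → + 0 ≤ p → + 0 ≤ r →
                   t * t ≤ (+ 3 * a) * c → p * a + r * c ≤ q * t →
                   + 4 * (p * r) ≤ + 3 * (q * q)
pa+rc≤qt⇒4pr≤3q² {a} {c} {p} {q} {r} {t} 0<a 0<c 0≤p 0≤r t²≤3ac pa+rc≤qt =
  *-cancelʳ-≤-pos _ _ (a * c) {{positive (0<i*j 0<a 0<c)}} (begin
    + 4 * (p * r) * (a * c)            ≡⟨ solve (a ∷ c ∷ p ∷ r ∷ []) ⟩
    + 4 * (p * a * (r * c))            ≤⟨ 4ij≤[i+j]² (p * a) (r * c) ⟩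
    (p * a + r * c) * (p * a + r * c)  ≤⟨ 0≤i≤j⇒i*i≤j*j 0≤pa+rc pa+rc≤qt ⟩
    q * t * (q * t)                    ≡⟨ solve (q ∷ t ∷ []) ⟩
    q * q * (t * t)                    ≤⟨ *-monoˡ-≤-nonNeg (q * q) {{nonNegative (0≤i*i q)}} t²≤3ac ⟩
    q * q * (+ 3 * a * c)              ≡⟨ solve (a ∷ c ∷ q ∷ []) ⟩
    + 3 * (q * q) * (a * c)            ∎)
  where
  open ≤-Reasoning
  0≤pa+rc : + 0 ≤ p * a + r * c
  0≤pa+rc = +-mono-≤ (0≤i*j 0≤p (<⇒≤ 0<a)) (0≤i*j 0≤r (<⇒≤ 0<c))

2*nC2≡n*[n∸1] : ∀ n → 2 ℕ.* (n C 2) ≡ n ℕ.* (n ∸ 1)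
2*nC2≡n*[n∸1] zero = refl
2*nC2≡n*[n∸1] (suc zero) = refl
2*nC2≡n*[n∸1] (suc (suc k)) = begin
  2 ℕ.* (suc (suc k) C 2)
    ≡⟨ cong (2 ℕ.*_) (sym (nCk+nC[k+1]≡[n+1]C[k+1] (suc k) 1)) ⟩
  2 ℕ.* (suc k C 1 ℕ.+ suc k C 2)
    ≡⟨ cong (λ t → 2 ℕ.* (t ℕ.+ suc k C 2)) (nC1≡n (suc k)) ⟩
  2 ℕ.* (suc k ℕ.+ suc k C 2)
    ≡⟨ ℕ.*-distribˡ-+ 2 (suc k) (suc k C 2) ⟩
  2 ℕ.* suc k ℕ.+ 2 ℕ.* (suc k C 2)
    ≡⟨ cong (2 ℕ.* suc k ℕ.+_) (2*nC2≡n*[n∸1] (suc k)) ⟩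
  2 ℕ.* (1 ℕ.+ k) ℕ.+ (1 ℕ.+ k) ℕ.* k
    ≡⟨ ℕ-Solver.solve (k ∷ []) ⟩
  (2 ℕ.+ k) ℕ.* (1 ℕ.+ k)
    ∎
  where open ≡-Reasoning

-- Each `rearrange` starts from the normal form of β h k d, in which sgn and (d ∸ k) C 0 are evaluated.
β₁≡ : ∀ h d → β h 1 d ≡ h 1 - + d * h 0
β₁≡ h d rewrite nC1≡n d = rearrange (+ d) (h 0) (h 1)
  where
  rearrange : ∀ D x y → - + 1 * (D * x) + + 1 * (+ 1 * y) ≡ y - D * x
  rearrange = solve-∀

β₂≡ : ∀ h d → β h 2 d ≡ + (d C 2) * h 0 - + (d ∸ 1) * h 1 + h 2
β₂≡ h d rewrite nC1≡n (d ∸ 1) = rearrange (+ (d C 2)) (+ (d ∸ 1)) (h 0) (h 1) (h 2)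
  where
  rearrange : ∀ X N x y z →
              + 1 * (X * x) + - + 1 * (N * y) + + 1 * (+ 1 * z) ≡ X * x - N * y + z
  rearrange = solve-∀

n*β₁+2*β₂≡2*h₂-n*h₁ : ∀ h n →
  + n * β h 1 (suc n) + + 2 * β h 2 (suc n) ≡ + 2 * h 2 - + n * h 1
n*β₁+2*β₂≡2*h₂-n*h₁ h n rewrite β₁≡ h (suc n) | β₂≡ h (suc n) =
  cancel (+ n) (+ (suc n C 2)) (h 0) (h 1) (h 2) 2*[1+n]C2≡[1+n]*n
  where
  2*[1+n]C2≡[1+n]*n : + 2 * + (suc n C 2) ≡ (+ 1 + + n) * + n
  2*[1+n]C2≡[1+n]*n = begin
    + 2 * + (suc n C 2)       ≡⟨ pos-* 2 (suc n C 2) ⟨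
    + (2 ℕ.* (suc n C 2))     ≡⟨ cong +_ (2*nC2≡n*[n∸1] (suc n)) ⟩
    + (suc n ℕ.* n)           ≡⟨ pos-* (suc n) n ⟩
    (+ 1 + + n) * + n         ∎
    where open ≡-Reasoning
  cancel : ∀ N X x y z → + 2 * X ≡ (+ 1 + N) * N →
           N * (y - (+ 1 + N) * x) + + 2 * (X * x - N * y + z) ≡ + 2 * z - N * y
  cancel N X x y z 2X≡[1+N]N = begin
    N * (y - (+ 1 + N) * x) + + 2 * (X * x - N * y + z)
      ≡⟨ solve (N ∷ X ∷ x ∷ y ∷ z ∷ []) ⟩
    + 2 * X * x - (+ 1 + N) * N * x + (+ 2 * z - N * y)
      ≡⟨ cong (λ t → t * x - (+ 1 + N) * N * x + (+ 2 * z - N * y)) 2X≡[1+N]N ⟩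
    (+ 1 + N) * N * x - (+ 1 + N) * N * x + (+ 2 * z - N * y)
      ≡⟨ solve (N ∷ x ∷ y ∷ z ∷ []) ⟩
    + 2 * z - N * y
      ∎
    where open ≡-Reasoning

β₁-nonneg⇒h₀≤h₁ : ∀ h d → + 0 ≤ h 0 → + 0 ≤ β h 1 (suc d) → h 0 ≤ h 1
β₁-nonneg⇒h₀≤h₁ h d 0≤h₀ 0≤β₁ = begin
  h 0            ≡⟨ *-identityˡ (h 0) ⟨
  + 1 * h 0      ≤⟨ *-monoʳ-≤-nonNeg (h 0) {{nonNegative 0≤h₀}} (+≤+ (s≤s (z≤n {d}))) ⟩
  + suc d * h 0  ≤⟨ 0≤i-j⇒j≤i (subst (+ 0 ≤_) (β₁≡ h (suc d)) 0≤β₁) ⟩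
  h 1            ∎
  where open ≤-Reasoning

β₁,β₂-nonneg⇒n*h₁≤2*h₂ : ∀ h n → + 0 ≤ β h 1 (suc n) → + 0 ≤ β h 2 (suc n) →
                         + n * h 1 ≤ + 2 * h 2
β₁,β₂-nonneg⇒n*h₁≤2*h₂ h n 0≤β₁ 0≤β₂ = 0≤i-j⇒j≤i (subst (+ 0 ≤_) (n*β₁+2*β₂≡2*h₂-n*h₁ h n)
  (+-mono-≤ (0≤i*j {+ n} (+≤+ z≤n) 0≤β₁) (0≤i*j {+ 2} (+≤+ z≤n) 0≤β₂)))

hdepth≤-mono : ∀ {h m n} → m ℕ.≤ n → HdepthAtMost h m → HdepthAtMost h n
hdepth≤-mono m≤n hdepth≤m d adm = ℕ.≤-trans (hdepth≤m d adm) m≤n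

¬admissible>m⇒hdepth≤m : ∀ {h} m → (∀ k → ¬ HdepthAdmissible h (suc m ℕ.+ k)) →
                         HdepthAtMost h m
¬admissible>m⇒hdepth≤m m ¬admissible d adm with d ℕ.≤? m
... | yes d≤m = d≤m
... | no d≰m with ℕ.m≤n⇒∃[o]m+o≡n (ℕ.≰⇒> d≰m)
...   | k , refl = contradiction adm (¬admissible k)

2*h₂<m*h₁⇒hdepth≤m : ∀ {h m} → 1 ℕ.≤ m → + 0 ≤ h 0 → + 2 * h 2 < + m * h 1 →
                     HdepthAtMost h m
2*h₂<m*h₁⇒hdepth≤m _ _ _ zero _ = z≤n
2*h₂<m*h₁⇒hdepth≤m 1≤m _ _ (suc zero) _ = 1≤m
2*h₂<m*h₁⇒hdepth≤m {h} _ 0≤h₀ 2h₂<mh₁ (suc (suc k)) adm =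
  drop‿+<+ (*-cancelʳ-<-nonNeg (h 1) {{nonNegative 0≤h₁}} (≤-<-trans [1+k]h₁≤2h₂ 2h₂<mh₁))
  where
  0≤β₁ : + 0 ≤ β h 1 (2 ℕ.+ k)
  0≤β₁ = adm 1 (s≤s z≤n)
  0≤h₁ : + 0 ≤ h 1
  0≤h₁ = ≤-trans 0≤h₀ (β₁-nonneg⇒h₀≤h₁ h (suc k) 0≤h₀ 0≤β₁)
  [1+k]h₁≤2h₂ : + suc k * h 1 ≤ + 2 * h 2
  [1+k]h₁≤2h₂ = β₁,β₂-nonneg⇒n*h₁≤2*h₂ h (suc k) 0≤β₁ (adm 2 (s≤s (s≤s z≤n)))

cubic-at-0 : ∀ a b c e → cubic a b c e 0 ≡ e
cubic-at-0 a b c e = begin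
  a * (+ 0 * + 0 * + 0) + b * (+ 0 * + 0) + c * + 0 + e  ≡⟨ solve (a ∷ b ∷ c ∷ e ∷ []) ⟩
  e                                                      ∎
  where open ≡-Reasoning

cubic-at-1 : ∀ a b c e → cubic a b c e 1 ≡ a + b + c + e
cubic-at-1 a b c e = begin
  a * (+ 1 * + 1 * + 1) + b * (+ 1 * + 1) + c * + 1 + e  ≡⟨ solve (a ∷ b ∷ c ∷ e ∷ []) ⟩
  a + b + c + e                                          ∎
  where open ≡-Reasoning

cubic-at-2 : ∀ a b c e → cubic a b c e 2 ≡ + 8 * a + + 4 * b + + 2 * c + e
cubic-at-2 a b c e = begin
  a * (+ 2 * + 2 * + 2) + b * (+ 2 * + 2) + c * + 2 + e  ≡⟨ solve (a ∷ b ∷ c ∷ e ∷ []) ⟩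
  + 8 * a + + 4 * b + + 2 * c + e                        ∎
  where open ≡-Reasoning

cubic-hdepth≤16 : ∀ a b c e → + 0 < e → + 0 ≤ b → + 0 ≤ c → HdepthAtMost (cubic a b c e) 16
cubic-hdepth≤16 a b c e 0<e 0≤b 0≤c =
  2*h₂<m*h₁⇒hdepth≤m (s≤s z≤n) (subst (+ 0 ≤_) (sym (cubic-at-0 a b c e)) (<⇒≤ 0<e)) 2h₂<16h₁
  where
  0<slack : + 0 < + 8 * b + + 12 * c + + 14 * e
  0<slack = +-mono-≤-< (+-mono-≤ (0≤i*j {+ 8} (+≤+ z≤n) 0≤b) (0≤i*j {+ 12} (+≤+ z≤n) 0≤c))
                       (0<i*j {+ 14} (+<+ z<s) 0<e)
  2h₂<16h₁ : + 2 * cubic a b c e 2 < + 16 * cubic a b c e 1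
  2h₂<16h₁ = begin-strict
    + 2 * cubic a b c e 2
      <⟨ i<i+j (+ 2 * cubic a b c e 2) 0<slack ⟩
    + 2 * cubic a b c e 2 + (+ 8 * b + + 12 * c + + 14 * e)
      ≡⟨ cong (λ t → + 2 * t + (+ 8 * b + + 12 * c + + 14 * e)) (cubic-at-2 a b c e) ⟩
    + 2 * (+ 8 * a + + 4 * b + + 2 * c + e) + (+ 8 * b + + 12 * c + + 14 * e)
      ≡⟨ solve (a ∷ b ∷ c ∷ e ∷ []) ⟩
    + 16 * (a + b + c + e)
      ≡⟨ cong (+ 16 *_) (cubic-at-1 a b c e) ⟨
    + 16 * cubic a b c e 1
      ∎
    where open ≤-Reasoning

N*h₁≤2*h₂⇒[N-16]a+[N-4]c≤[N-8][-b] : ∀ {a b c e} N → + 2 ≤ N → + 0 ≤ e →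
  N * (a + b + c + e) ≤ + 2 * (+ 8 * a + + 4 * b + + 2 * c + e) →
  (N - + 16) * a + (N - + 4) * c ≤ (N - + 8) * - b
N*h₁≤2*h₂⇒[N-16]a+[N-4]c≤[N-8][-b] {a} {b} {c} {e} N 2≤N 0≤e Nh₁≤2h₂ = begin
  (N - + 16) * a + (N - + 4) * c
    ≤⟨ i≤i+j _ _ {{nonNegative 0≤slack}} ⟩
  (N - + 16) * a + (N - + 4) * c
    + ((N - + 2) * e + (+ 2 * (+ 8 * a + + 4 * b + + 2 * c + e) - N * (a + b + c + e)))
    ≡⟨ solve (N ∷ a ∷ b ∷ c ∷ e ∷ []) ⟩
  (N - + 8) * - b
    ∎
  where
  open ≤-Reasoning
  0≤slack : + 0 ≤ (N - + 2) * e + (+ 2 * (+ 8 * a + + 4 * b + + 2 * c + e) - N * (a + b + c + e))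
  0≤slack = +-mono-≤ (0≤i*j (i≤j⇒0≤j-i 2≤N) 0≤e) (i≤j⇒0≤j-i Nh₁≤2h₂)

30≤N⇒3[N-8]²<4[N-16][N-4] : ∀ {N} → + 30 ≤ N →
  + 3 * ((N - + 8) * (N - + 8)) < + 4 * ((N - + 16) * (N - + 4))
30≤N⇒3[N-8]²<4[N-16][N-4] {N} 30≤N = begin-strict
  + 3 * ((N - + 8) * (N - + 8))
    <⟨ i<i+j (+ 3 * ((N - + 8) * (N - + 8))) (+-mono-≤-< 0≤[N-30][N-2] (+<+ (z<s {3}))) ⟩
  + 3 * ((N - + 8) * (N - + 8)) + ((N - + 30) * (N - + 2) + + 4)
    ≡⟨ solve (N ∷ []) ⟩
  + 4 * ((N - + 16) * (N - + 4))
    ∎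
  where
  open ≤-Reasoning
  0≤[N-30][N-2] : + 0 ≤ (N - + 30) * (N - + 2)
  0≤[N-30][N-2] = 0≤i*j (i≤j⇒0≤j-i 30≤N) (i≤j⇒0≤j-i (≤-trans (+≤+ (ℕ.m≤m+n 2 28)) 30≤N))

cubic-β-bounds-contradict : ∀ {a b c e} N → + 30 ≤ N → + 0 < e → b < + 0 →
  b * b ≤ (+ 3 * a) * c → e ≤ a + b + c + e →
  N * (a + b + c + e) ≤ + 2 * (+ 8 * a + + 4 * b + + 2 * c + e) → ⊥
cubic-β-bounds-contradict {a} {b} {c} {e} N 30≤N 0<e b<0 b²≤3ac e≤h₁ Nh₁≤2h₂ =
  <⇒≱ (30≤N⇒3[N-8]²<4[N-16][N-4] 30≤N) (pa+rc≤qt⇒4pr≤3q² {q = N - + 8} {t = - b}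
    0<a 0<c (0≤N-k (ℕ.m≤m+n 16 14)) (0≤N-k (ℕ.m≤m+n 4 26)) [-b]²≤3ac
    (N*h₁≤2*h₂⇒[N-16]a+[N-4]c≤[N-8][-b] N (k≤N (ℕ.m≤m+n 2 28)) (<⇒≤ 0<e) Nh₁≤2h₂))
  where
  open ≤-Reasoning
  k≤N : ∀ {k} → k ℕ.≤ 30 → + k ≤ N
  k≤N k≤30 = ≤-trans (+≤+ k≤30) 30≤N
  0≤N-k : ∀ {k} → k ℕ.≤ 30 → + 0 ≤ N - + k
  0≤N-k k≤30 = i≤j⇒0≤j-i (k≤N k≤30)
  0<-b : + 0 < - b
  0<-b = neg-mono-< b<0
  [-b]²≤3ac : - b * - b ≤ (+ 3 * a) * c
  [-b]²≤3ac = begin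
    - b * - b    ≡⟨ solve (b ∷ []) ⟩
    b * b        ≤⟨ b²≤3ac ⟩
    + 3 * a * c  ∎
  0<ac : + 0 < a * c
  0<ac = *-cancelˡ-<-nonNeg (+ 3) (begin-strict
    + 0            <⟨ 0<i*j 0<-b 0<-b ⟩
    - b * - b      ≤⟨ [-b]²≤3ac ⟩
    + 3 * a * c    ≡⟨ *-assoc (+ 3) a c ⟩
    + 3 * (a * c)  ∎)
  0<a+c : + 0 < a + c
  0<a+c = begin-strict
    + 0                      <⟨ 0<-b ⟩
    - b                      ≤⟨ i≤j+i (- b) _ {{nonNegative (i≤j⇒0≤j-i e≤h₁)}} ⟩
    a + b + c + e - e + - b  ≡⟨ solve (a ∷ b ∷ c ∷ e ∷ []) ⟩
    a + c                    ∎
  0<a : + 0 < a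
  0<a = 0<i*j∧0<i+j⇒0<i 0<ac 0<a+c
  0<c : + 0 < c
  0<c = 0<i*j∧0<i+j⇒0<i (subst (+ 0 <_) (*-comm a c) 0<ac) (subst (+ 0 <_) (+-comm a c) 0<a+c)

cubic-hdepth≤30 : ∀ a b c e → + 0 < e → b < + 0 → b * b ≤ (+ 3 * a) * c →
                  HdepthAtMost (cubic a b c e) 30
cubic-hdepth≤30 a b c e 0<e b<0 b²≤3ac = ¬admissible>m⇒hdepth≤m 30 ¬admissible
  where
  h = cubic a b c e
  ¬admissible : ∀ k → ¬ HdepthAdmissible h (31 ℕ.+ k)
  ¬admissible k adm =
    cubic-β-bounds-contradict {a} {b} {c} {e} N (+≤+ (ℕ.m≤m+n 30 k)) 0<e b<0 b²≤3ac
      (subst₂ _≤_ (cubic-at-0 a b c e) (cubic-at-1 a b c e)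
        (β₁-nonneg⇒h₀≤h₁ h (30 ℕ.+ k) 0≤h₀ 0≤β₁))
      (subst₂ (λ x y → N * x ≤ + 2 * y) (cubic-at-1 a b c e) (cubic-at-2 a b c e)
        (β₁,β₂-nonneg⇒n*h₁≤2*h₂ h (30 ℕ.+ k) 0≤β₁ (adm 2 (s≤s (s≤s z≤n)))))
    where
    N = + (30 ℕ.+ k)
    0≤h₀ : + 0 ≤ h 0
    0≤h₀ = subst (+ 0 ≤_) (sym (cubic-at-0 a b c e)) (<⇒≤ 0<e)
    0≤β₁ : + 0 ≤ β h 1 (31 ℕ.+ k)
    0≤β₁ = adm 1 (s≤s z≤n)

theorem3p5 : (a b c e : ℤ) → a ≢ + 0 → e > + 0
    → (∀ (j : ℕ) → + 0 ≤ cubic a b c e j)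
    → ((+ 0 ≤ b → + 0 ≤ c → HdepthAtMost (cubic a b c e) 16)
       × (b < + 0 → b * b ≤ (+ 3 * a) * c → HdepthAtMost (cubic a b c e) 67))
-- a ≢ 0 and h₃ ≥ 0 only place h₃ in 𝓗₀; the bounds do not use them.
theorem3p5 a b c e _ 0<e _ =
    cubic-hdepth≤16 a b c e 0<e
  , λ b<0 b²≤3ac → hdepth≤-mono (ℕ.m≤m+n 30 37) (cubic-hdepth≤30 a b c e 0<e b<0 b²≤3ac)
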